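{- Let $\mathcal L$ be any of the logics $L$, $L3$, $L4$, $L5$, $ELn^-$, $ELn$, $EkLn^-$, $EkLn$ ($n\in\{3,4,5\}$, $k\in\{4,5,6\}$). Then $\vdash_{\mathcal L}\varphi\leftrightarrow\psi$ does not in general imply $\vdash_{\mathcal L}\chi[x:=\varphi]\leftrightarrow\chi[x:=\psi]$; that is, there exist formulas $\varphi,\psi,\chi$ and a variable $x$ such that $\varphi\leftrightarrow\psi$ is a theorem of $\mathcal L$ but $\chi[x:=\varphi]\leftrightarrow\chi[x:=\psi]$ is not.
   Context: Formulas $Fm$ are built from an infinite set $V$ of propositional variables using $\bot,\wedge,\vee,\rightarrow$ and unary operators $\square$ and $K$; $Fm_1$ is the set of formulas without $K$. $\varphi[x:=\psi]$ denotes the result of simultaneously replacing all occurrences of the variable $x$ in $\varphi$ by $\psi$. Abbreviations: $\neg\varphi:=\varphi\rightarrow\bot$, $\top:=\neg\bot$, $\varphi\leftrightarrow\psi:=(\varphi\rightarrow\psi)\wedge(\psi\rightarrow\varphi)$, $\varphi\equiv\psi:=\square(\varphi\leftrightarrow\psi)$. Axiom schemes: (INT) all theorems of intuitionistic propositional logic and their substitution-instances; (A1) $\square(\varphi\vee\psi)\rightarrow(\square\varphi\vee\square\psi)$; (A2) $\square\varphi\rightarrow\varphi$; (A3) $\square(\varphi\rightarrow\psi)\rightarrow\square(\square\varphi\rightarrow\square\psi)$; (A4) $\square\varphi\rightarrow\square\square\varphi$; (A5) $\neg\square\varphi\rightarrow\square\neg\square\varphi$; (KBel) $K(\varphi\rightarrow\psi)\rightarrow(K\varphi\rightarrow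 K\psi)$; (CoRe) $\square\varphi\rightarrow\square K\varphi$; (IntRe) $K\varphi\rightarrow\neg\neg\varphi$; (E4) $K\varphi\rightarrow KK\varphi$; (E5) $\neg K\varphi\rightarrow K\neg K\varphi$; (PNB) $K\varphi\rightarrow\square K\varphi$; (NNB) $\neg K\varphi\rightarrow\square\neg K\varphi$. Theorem scheme (TND): $\varphi\vee\neg\varphi$. Rules: Modus Ponens (MP); Axiom Necessitation (AN): if $\varphi$ is an axiom of the system, infer $\square\varphi$ (AN applies only to axioms). A theorem of $\mathcal L$ is the last member of a finite sequence each member of which is an axiom of $\mathcal L$, an instance of a theorem scheme of $\mathcal L$, a formula $\square\psi$ with $\psi$ an axiom of $\mathcal L$, or follows from two earlier members by MP. Systems: $L$ (language $Fm_1$) has axiom schemes (INT),(A1),(A2) and $\square(\varphi\rightarrow\psi)\rightarrow(\square(\psi\rightarrow\chi)\rightarrow\square(\varphi\rightarrow\chi))$, theorem schemes (TND) and (SP) $(\varphi\equiv\psi)\rightarrow(\chi[x:=\varphi]\equiv\chi[x:=\psi])$, rules MP, AN. $L3$ (language $Fm_1$) has axiom schemes (INT),(A1),(A2),(A3), theorem scheme (TND), rules MP, AN; $L4=L3+$(A4); $L5=L4+$(A5). Over $Fm$: $EL3^-=L3+$(KBel)$+$(CoRe), $EL4^-=EL3^-+$(A4), $EL5^-=EL4^-+$(A5); for $n\in\{3,4,5\}$: $E4Ln^-=ELn^-+$(E4), $E5Ln^-=E4Ln^-+$(E5), $E6Ln^-=ELn^-+$(PNB)$+$(NNB), $ELn=ELn^-+$(IntRe),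 $EkLn=EkLn^-+$(IntRe) for $k\in\{4,5,6\}$. -}

module Defs where

open import Data.Nat using (ℕ; _≟_)
open import Data.Empty using (⊥)
open import Data.Unit using (⊤)
open import Data.Product using (_×_)
open import Relation.Nullary using (yes; no)

infixr 20 _⇒_
infixl 25 _∨′_
infixl 30 _∧′_

data Fm : Set where
  var  : ℕ → Fm
  ⊥′   : Fm
  _∧′_ : Fm → Fm → Fm
  _∨′_ : Fm → Fm → Fm
  _⇒_  : Fm → Fm → Fm
  □    : Fm → Fm
  K    : Fm → Fm

¬′_ : Fm → Fm
¬′ φ = φ ⇒ ⊥′

⊤′ : Fm
⊤′ = ¬′ ⊥′

_⇔_ : Fm → Fm → Fm
φ ⇔ ψ = (φ ⇒ ψ) ∧′ (ψ ⇒ φ)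

_≡′_ : Fm → Fm → Fm
φ ≡′ ψ = □ (φ ⇔ ψ)

_[_:=_] : Fm → ℕ → Fm → Fm
var y     [ x := ψ ] with y ≟ x
... | yes _ = ψ
... | no  _ = var y
⊥′        [ x := ψ ] = ⊥′
(φ ∧′ χ)  [ x := ψ ] = (φ [ x := ψ ]) ∧′ (χ [ x := ψ ])
(φ ∨′ χ)  [ x := ψ ] = (φ [ x := ψ ]) ∨′ (χ [ x := ψ ])
(φ ⇒ χ)   [ x := ψ ] = (φ [ x := ψ ]) ⇒ (χ [ x := ψ ])
□ φ       [ x := ψ ] = □ (φ [ x := ψ ])
K φ       [ x := ψ ] = K (φ [ x := ψ ])

NoK : Fm → Set
NoK (var _)  = ⊤
NoK ⊥′       = ⊤
NoK (φ ∧′ ψ) = NoK φ × NoK ψ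
NoK (φ ∨′ ψ) = NoK φ × NoK ψ
NoK (φ ⇒ ψ)  = NoK φ × NoK ψ
NoK (□ φ)    = NoK φ
NoK (K _)    = ⊥

-- (INT): theorems of intuitionistic propositional logic and their
-- substitution instances = formulas derivable in a standard Hilbert
-- calculus for IPC whose schemes range over all of Fm (□φ, Kφ are
-- treated as atoms).

data IPC : Fm → Set where
  ik   : ∀ {φ ψ}   → IPC (φ ⇒ (ψ ⇒ φ))
  is   : ∀ {φ ψ χ} → IPC ((φ ⇒ (ψ ⇒ χ)) ⇒ ((φ ⇒ ψ) ⇒ (φ ⇒ χ)))
  ∧e₁  : ∀ {φ ψ}   → IPC ((φ ∧′ ψ) ⇒ φ)
  ∧e₂  : ∀ {φ ψ}   → IPC ((φ ∧′ ψ) ⇒ ψ)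
  ∧i   : ∀ {φ ψ}   → IPC (φ ⇒ (ψ ⇒ (φ ∧′ ψ)))
  ∨i₁  : ∀ {φ ψ}   → IPC (φ ⇒ (φ ∨′ ψ))
  ∨i₂  : ∀ {φ ψ}   → IPC (ψ ⇒ (φ ∨′ ψ))
  ∨e   : ∀ {φ ψ χ} → IPC ((φ ⇒ χ) ⇒ ((ψ ⇒ χ) ⇒ ((φ ∨′ ψ) ⇒ χ)))
  efq  : ∀ {φ}     → IPC (⊥′ ⇒ φ)
  imp  : ∀ {φ ψ}   → IPC (φ ⇒ ψ) → IPC φ → IPC ψ

data N : Set where
  n3 n4 n5 : N

data Kk : Set where
  k4 k5 k6 : Kk

data Logic : Set where
  L     : Logic
  Ln    : N → Logic
  ELn⁻  : N → Logic
  ELn   : N → Logic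
  EkLn⁻ : Kk → N → Logic
  EkLn  : Kk → N → Logic

Lang : Logic → Fm → Set
Lang L        φ = NoK φ
Lang (Ln _)   φ = NoK φ
Lang _        _ = ⊤

Has3 : Logic → Set
Has3 L = ⊥
Has3 _ = ⊤

atLeast4 : N → Set
atLeast4 n3 = ⊥
atLeast4 _  = ⊤

is5 : N → Set
is5 n5 = ⊤
is5 _  = ⊥

Has4 : Logic → Set
Has4 L           = ⊥
Has4 (Ln n)      = atLeast4 n
Has4 (ELn⁻ n)    = atLeast4 n
Has4 (ELn n)     = atLeast4 n
Has4 (EkLn⁻ _ n) = atLeast4 n
Has4 (EkLn _ n)  = atLeast4 n

Has5 : Logic → Set
Has5 L           = ⊥
Has5 (Ln n)      = is5 n
Has5 (ELn⁻ n)    = is5 n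
Has5 (ELn n)     = is5 n
Has5 (EkLn⁻ _ n) = is5 n
Has5 (EkLn _ n)  = is5 n

Epist : Logic → Set
Epist L      = ⊥
Epist (Ln _) = ⊥
Epist _      = ⊤

HasIntRe : Logic → Set
HasIntRe (ELn _)    = ⊤
HasIntRe (EkLn _ _) = ⊤
HasIntRe _          = ⊥

kE4 : Kk → Set
kE4 k6 = ⊥
kE4 _  = ⊤

kE5 : Kk → Set
kE5 k5 = ⊤
kE5 _  = ⊥

kE6 : Kk → Set
kE6 k6 = ⊤
kE6 _  = ⊥

HasE4 HasE5 HasE6 : Logic → Set
HasE4 (EkLn⁻ k _) = kE4 k
HasE4 (EkLn k _)  = kE4 k
HasE4 _           = ⊥
HasE5 (EkLn⁻ k _) = kE5 k
HasE5 (EkLn k _)  = kE5 k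
HasE5 _           = ⊥
HasE6 (EkLn⁻ k _) = kE6 k
HasE6 (EkLn k _)  = kE6 k
HasE6 _           = ⊥

IsL : Logic → Set
IsL L = ⊤
IsL _ = ⊥

data Ax (𝓛 : Logic) : Fm → Set where
  INT   : ∀ {φ} → IPC φ → Lang 𝓛 φ → Ax 𝓛 φ
  A1    : ∀ {φ ψ} → Lang 𝓛 (□ (φ ∨′ ψ) ⇒ (□ φ ∨′ □ ψ)) →
          Ax 𝓛 (□ (φ ∨′ ψ) ⇒ (□ φ ∨′ □ ψ))
  A2    : ∀ {φ} → Lang 𝓛 (□ φ ⇒ φ) → Ax 𝓛 (□ φ ⇒ φ)
  Atr   : ∀ {φ ψ χ} → IsL 𝓛 →
          Lang 𝓛 (□ (φ ⇒ ψ) ⇒ (□ (ψ ⇒ χ) ⇒ □ (φ ⇒ χ))) →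
          Ax 𝓛 (□ (φ ⇒ ψ) ⇒ (□ (ψ ⇒ χ) ⇒ □ (φ ⇒ χ)))
  A3    : ∀ {φ ψ} → Has3 𝓛 →
          Lang 𝓛 (□ (φ ⇒ ψ) ⇒ □ (□ φ ⇒ □ ψ)) →
          Ax 𝓛 (□ (φ ⇒ ψ) ⇒ □ (□ φ ⇒ □ ψ))
  A4    : ∀ {φ} → Has4 𝓛 → Lang 𝓛 (□ φ ⇒ □ (□ φ)) → Ax 𝓛 (□ φ ⇒ □ (□ φ))
  A5    : ∀ {φ} → Has5 𝓛 → Lang 𝓛 ((¬′ (□ φ)) ⇒ □ (¬′ (□ φ))) →
          Ax 𝓛 ((¬′ (□ φ)) ⇒ □ (¬′ (□ φ)))
  KBel  : ∀ {φ ψ} → Epist 𝓛 → Ax 𝓛 (K (φ ⇒ ψ) ⇒ (K φ ⇒ K ψ))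
  CoRe  : ∀ {φ} → Epist 𝓛 → Ax 𝓛 (□ φ ⇒ □ (K φ))
  IntRe : ∀ {φ} → HasIntRe 𝓛 → Ax 𝓛 (K φ ⇒ ¬′ (¬′ φ))
  E4    : ∀ {φ} → HasE4 𝓛 → Ax 𝓛 (K φ ⇒ K (K φ))
  E5    : ∀ {φ} → HasE5 𝓛 → Ax 𝓛 ((¬′ (K φ)) ⇒ K (¬′ (K φ)))
  PNB   : ∀ {φ} → HasE6 𝓛 → Ax 𝓛 (K φ ⇒ □ (K φ))
  NNB   : ∀ {φ} → HasE6 𝓛 → Ax 𝓛 ((¬′ (K φ)) ⇒ □ (¬′ (K φ)))

data TS (𝓛 : Logic) : Fm → Set where
  TND : ∀ {φ} → Lang 𝓛 φ → TS 𝓛 (φ ∨′ (¬′ φ))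
  SP  : ∀ {φ ψ χ x} → IsL 𝓛 →
        Lang 𝓛 ((φ ≡′ ψ) ⇒ ((χ [ x := φ ]) ≡′ (χ [ x := ψ ]))) →
        TS 𝓛 ((φ ≡′ ψ) ⇒ ((χ [ x := φ ]) ≡′ (χ [ x := ψ ])))

infix 5 _⊢_
data _⊢_ (𝓛 : Logic) : Fm → Set where
  ax : ∀ {φ} → Ax 𝓛 φ → 𝓛 ⊢ φ
  ts : ∀ {φ} → TS 𝓛 φ → 𝓛 ⊢ φ
  an : ∀ {φ} → Ax 𝓛 φ → 𝓛 ⊢ □ φ
  mp : ∀ {φ ψ} → 𝓛 ⊢ (φ ⇒ ψ) → 𝓛 ⊢ φ → 𝓛 ⊢ ψ

-- Take the two-world intuitionistic model root ≤ top (false ≤ true), with every variable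
-- true exactly at top, and read both □φ and Kφ as "φ holds at the root" (by persistence:
-- everywhere). Every axiom, hence every necessitated axiom, holds at both worlds, while
-- (TND) and (SP) hold at top; so every theorem holds at top. Now p ∨ ¬p is a theorem and so
-- is ⊤ ↔ (p ∨ ¬p), but TND is not necessitated: p ∨ ¬p fails at the root, so □⊤ ↔ □(p ∨ ¬p)
-- fails at top and is not a theorem. Take χ = □x.
module Submission where

open import Defs
open import Data.Bool using (Bool; true; false; T)
open import Data.Bool.Base using (_≤_; f≤t; b≤b)
open import Data.Bool.Properties using (≤-trans; ≤-minimum)
open import Data.Empty using () renaming (⊥ to Empty)
open import Data.Nat using (ℕ; _≟_)
open import Data.Product using (Σ; _×_; _,_; proj₁; proj₂; swap)
open import Data.Sum using (_⊎_; inj₁; inj₂; [_,_])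
open import Data.Unit using (tt)
open import Relation.Nullary using (¬_; Dec; yes; no)
open import Relation.Nullary.Decidable using (map′; _×-dec_; _⊎-dec_; _→-dec_)

World : Set
World = Bool

infix 4 _⊩_

_⊩_ : World → Fm → Set
w ⊩ var _    = T w
w ⊩ ⊥′       = Empty
w ⊩ φ ∧′ ψ   = w ⊩ φ × w ⊩ ψ
w ⊩ φ ∨′ ψ   = w ⊩ φ ⊎ w ⊩ ψ
w ⊩ φ ⇒ ψ    = ∀ v → w ≤ v → v ⊩ φ → v ⊩ ψ
w ⊩ □ φ      = false ⊩ φ
w ⊩ K φ      = false ⊩ φ

⊩-mono : ∀ {w v} φ → w ≤ v → w ⊩ φ → v ⊩ φ
⊩-mono φ        b≤b h         = h
⊩-mono (φ ∧′ ψ) f≤t (h₁ , h₂) = ⊩-mono φ f≤t h₁ , ⊩-mono ψ f≤t h₂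
⊩-mono (φ ∨′ ψ) f≤t (inj₁ h)  = inj₁ (⊩-mono φ f≤t h)
⊩-mono (φ ∨′ ψ) f≤t (inj₂ h)  = inj₂ (⊩-mono ψ f≤t h)
⊩-mono (φ ⇒ ψ)  f≤t h         = λ v q → h v (≤-trans f≤t q)
⊩-mono (□ φ)    f≤t h         = h
⊩-mono (K φ)    f≤t h         = h

⊩-from-root : ∀ {φ} w → false ⊩ φ → w ⊩ φ
⊩-from-root {φ} w = ⊩-mono φ (≤-minimum w)

⊩-dec : ∀ w φ → Dec (w ⊩ φ)
⊩-dec false (var _)  = no λ ()
⊩-dec true  (var _)  = yes tt
⊩-dec w     ⊥′       = no λ ()
⊩-dec w     (φ ∧′ ψ) = ⊩-dec w φ ×-dec ⊩-dec w ψ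
⊩-dec w     (φ ∨′ ψ) = ⊩-dec w φ ⊎-dec ⊩-dec w ψ
⊩-dec true  (φ ⇒ ψ)  =
  map′ (λ f → λ { true b≤b → f }) (λ h → h true b≤b) (⊩-dec true φ →-dec ⊩-dec true ψ)
⊩-dec false (φ ⇒ ψ)  =
  map′ (λ (f , g) → λ { false b≤b → f ; true f≤t → g }) (λ h → h false b≤b , h true f≤t)
       ((⊩-dec false φ →-dec ⊩-dec false ψ) ×-dec (⊩-dec true φ →-dec ⊩-dec true ψ))
⊩-dec w     (□ φ)    = ⊩-dec false φ
⊩-dec w     (K φ)    = ⊩-dec false φ

⊩-excluded-middle-top : ∀ φ → true ⊩ φ ∨′ (¬′ φ)
⊩-excluded-middle-top φ with ⊩-dec true φ
... | yes h = inj₁ h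
... | no ¬h = inj₂ λ { true b≤b → ¬h }

⊮-excluded-middle-root : ∀ n → ¬ (false ⊩ var n ∨′ (¬′ var n))
⊮-excluded-middle-root n (inj₂ ¬p) = ¬p true f≤t tt

⊩-subst : ∀ {φ ψ} x χ → false ⊩ φ ⇔ ψ → ∀ w → w ⊩ χ [ x := φ ] → w ⊩ χ [ x := ψ ]
⊩-subst x (var y) e w h with y ≟ x
... | yes _ = proj₁ e w (≤-minimum w) h
... | no  _ = h
⊩-subst x ⊥′       e w h         = h
⊩-subst x (χ ∧′ ϑ) e w (h₁ , h₂) = ⊩-subst x χ e w h₁ , ⊩-subst x ϑ e w h₂
⊩-subst x (χ ∨′ ϑ) e w (inj₁ h)  = inj₁ (⊩-subst x χ e w h)
⊩-subst x (χ ∨′ ϑ) e w (inj₂ h)  = inj₂ (⊩-subst x ϑ e w h)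
⊩-subst x (χ ⇒ ϑ)  e w h         =
  λ v q a → ⊩-subst x ϑ e v (h v q (⊩-subst x χ (swap e) v a))
⊩-subst x (□ χ)    e w h         = ⊩-subst x χ e false h
⊩-subst x (K χ)    e w h         = ⊩-subst x χ e false h

⊩-SP : ∀ φ ψ χ x w → w ⊩ (φ ≡′ ψ) ⇒ ((χ [ x := φ ]) ≡′ (χ [ x := ψ ]))
⊩-SP φ ψ χ x w _ _ e =
  (λ v _ → ⊩-subst x χ e v) , (λ v _ → ⊩-subst x χ (swap e) v)

⊩-IPC : ∀ {φ} → IPC φ → ∀ w → w ⊩ φ
⊩-IPC (ik {φ})  w = λ v _ a u q _ → ⊩-mono φ q a
⊩-IPC is        w = λ _ _ f u q g t r a → f t (≤-trans q r) a t b≤b (g t r a)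
⊩-IPC ∧e₁       w = λ _ _ → proj₁
⊩-IPC ∧e₂       w = λ _ _ → proj₂
⊩-IPC (∧i {φ})  w = λ _ _ a u q b → ⊩-mono φ q a , b
⊩-IPC ∨i₁       w = λ _ _ → inj₁
⊩-IPC ∨i₂       w = λ _ _ → inj₂
⊩-IPC ∨e        w = λ _ _ f u q g t r → [ f t (≤-trans q r) , g t r ]
⊩-IPC efq       w = λ _ _ ()
⊩-IPC (imp d e) w = ⊩-IPC d w w b≤b (⊩-IPC e w)

⊩-Ax : ∀ {𝓛 φ} → Ax 𝓛 φ → ∀ w → w ⊩ φ
⊩-Ax (INT d _)     w = ⊩-IPC d w
⊩-Ax (A1 _)        w = λ _ _ h → h
⊩-Ax (A2 {φ} _)    w = λ v _ → ⊩-from-root {φ} v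
⊩-Ax (Atr _ _)     w = λ _ _ f _ _ g t r a → g t r (f t r a)
⊩-Ax (A3 _ _)      w = λ _ _ f _ _ a → f false b≤b a
⊩-Ax (A4 _ _)      w = λ _ _ h → h
⊩-Ax (A5 _ _)      w = λ v _ ¬h _ _ → ¬h v b≤b
⊩-Ax (KBel _)      w = λ _ _ f _ _ a → f false b≤b a
⊩-Ax (CoRe _)      w = λ _ _ h → h
⊩-Ax (IntRe {φ} _) w = λ _ _ h u _ ¬a → ¬a u b≤b (⊩-from-root {φ} u h)
⊩-Ax (E4 _)        w = λ _ _ h → h
⊩-Ax (E5 _)        w = λ v _ ¬h _ _ → ¬h v b≤b
⊩-Ax (PNB _)       w = λ _ _ h → h
⊩-Ax (NNB _)       w = λ v _ ¬h _ _ → ¬h v b≤b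

⊢-sound : ∀ {𝓛 φ} → 𝓛 ⊢ φ → true ⊩ φ
⊢-sound (ax a)                        = ⊩-Ax a true
⊢-sound (ts (TND {φ} _))              = ⊩-excluded-middle-top φ
⊢-sound (ts (SP {φ} {ψ} {χ} {x} _ _)) = ⊩-SP φ ψ χ x true
⊢-sound (an a)                        = ⊩-Ax a false
⊢-sound (mp d e)                      = ⊢-sound d true b≤b (⊢-sound e)

NoK⇒Lang : ∀ 𝓛 {φ} → NoK φ → Lang 𝓛 φ
NoK⇒Lang L           n = n
NoK⇒Lang (Ln _)      n = n
NoK⇒Lang (ELn⁻ _)    _ = tt
NoK⇒Lang (ELn _)     _ = tt
NoK⇒Lang (EkLn⁻ _ _) _ = tt
NoK⇒Lang (EkLn _ _)  _ = tt

⊢-IPC : ∀ 𝓛 {φ} → IPC φ → NoK φ → 𝓛 ⊢ φ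
⊢-IPC 𝓛 d n = ax (INT d (NoK⇒Lang 𝓛 n))

⊢-⊤ : ∀ 𝓛 → 𝓛 ⊢ ⊤′
⊢-⊤ 𝓛 = ⊢-IPC 𝓛 efq (tt , tt)

⊢-⇔-of-⊢ : ∀ 𝓛 {φ ψ} → NoK φ → NoK ψ → 𝓛 ⊢ φ → 𝓛 ⊢ ψ → 𝓛 ⊢ φ ⇔ ψ
⊢-⇔-of-⊢ 𝓛 {φ} {ψ} nφ nψ ⊢φ ⊢ψ =
  mp (mp (⊢-IPC 𝓛 (∧i {φ ⇒ ψ} {ψ ⇒ φ}) (φ⇒ψ , ψ⇒φ , φ⇒ψ , ψ⇒φ))
         (mp (⊢-IPC 𝓛 (ik {ψ} {φ}) (nψ , nφ , nψ)) ⊢ψ))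
     (mp (⊢-IPC 𝓛 (ik {φ} {ψ}) (nφ , nψ , nφ)) ⊢φ)
  where
  φ⇒ψ : NoK (φ ⇒ ψ)
  φ⇒ψ = nφ , nψ
  ψ⇒φ : NoK (ψ ⇒ φ)
  ψ⇒φ = nψ , nφ

excluded-middle : Fm
excluded-middle = var 1 ∨′ (¬′ var 1)

lemma3p5 : (𝓛 : Logic) →
    Σ Fm λ φ → Σ Fm λ ψ → Σ Fm λ χ → Σ ℕ λ x →
      Lang 𝓛 φ × Lang 𝓛 ψ × Lang 𝓛 χ ×
      (𝓛 ⊢ (φ ⇔ ψ)) × ¬ (𝓛 ⊢ ((χ [ x := φ ]) ⇔ (χ [ x := ψ ])))
lemma3p5 𝓛 =
  ⊤′ , excluded-middle , □ (var 0) , 0 ,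
  NoK⇒Lang 𝓛 (tt , tt) , NoK⇒Lang 𝓛 (tt , tt , tt) , NoK⇒Lang 𝓛 tt ,
  ⊢-⇔-of-⊢ 𝓛 (tt , tt) (tt , tt , tt) (⊢-⊤ 𝓛) (ts (TND (NoK⇒Lang 𝓛 tt))) ,
  not-□-equivalent
  where
  not-□-equivalent : ¬ (𝓛 ⊢ □ ⊤′ ⇔ □ excluded-middle)
  not-□-equivalent d =
    ⊮-excluded-middle-root 1 (proj₁ (⊢-sound d) true b≤b (⊩-IPC (efq {⊥′}) false))
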